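{- Let $b\ge 2$, $n\ge 0$, $i\ge 0$ be integers and let $p\in P_i(b,n)$. If $p_i\ne b-1$, then $\mathrm{Succ}_b(\mathrm{inc}_i(p))=\{\mathrm{inc}_i(q): q\in \mathrm{Succ}_b(p)\}$. If $p_i=b-1$, then $\mathrm{Succ}_b(\mathrm{inc}_i(p))=\{\mathrm{inc}_i(q): q\in \mathrm{Succ}_b(p)\}\cup\{\mathrm{inc}_{i+1}(p)\}$.
   Context: For an integer $n\ge 0$, a $b$-ary partition of $n$ is a sequence $p=(p_0,p_1,p_2,\dots)$ of non-negative integers, only finitely many nonzero, with $\sum_{i\ge 0}p_ib^i=n$; it is written as a finite tuple, later components being $0$; $(n)$ denotes $(n,0,0,\dots)$. For $i\ge 0$ and a $b$-ary partition $p$ with $p_i\ge b$, "firing $i$" transforms $p$ into $q$ with $q_i=p_i-b$, $q_{i+1}=p_{i+1}+1$ and $q_j=p_j$ for $j\notin\{i,i+1\}$; $q$ is called a successor of $p$, and $\mathrm{Succ}_b(p)$ denotes the set of all successors of $p$. $R_b(n)$ is the set of $b$-ary partitions of $n$ obtainable from $(n)$ by finitely many firings. For $i\ge 0$, $P_i(b,n)$ is the set of $p\in R_b(n)$ with $p_0=p_1=\dots=p_{i-1}=b-1$ (so $P_0(b,n)=R_b(n)$). For $p\in P_i(b,n)$, $\mathrm{inc}_i(p)=(0,\dots,0,p_i+1,p_{i+1},p_{i+2},\dots)$, i.e. the first $i$ components (equal to $b-1$) are replaced by $0$ and component $i$ is increased by $1$; this is a $b$-ary partition of $n+1$. -}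

module Defs where

open import Data.Nat using (ℕ; zero; suc; _+_; _∸_; _≤_; _<_; _<ᵇ_; _≡ᵇ_)
open import Data.Product using (Σ; _×_; _,_)
open import Data.Bool using (if_then_else_)
open import Relation.Binary.PropositionalEquality using (_≡_; _≢_)
open import Relation.Nullary using (¬_)

-- A b-ary partition is represented by its component function ℕ → ℕ
-- (p j = p_j).  Two partitions are equal iff they agree pointwise (_≗_).
Partition : Set
Partition = ℕ → ℕ

single : ℕ → Partition
single n zero    = n
single n (suc j) = 0

Fire : ℕ → ℕ → Partition → Partition → Set
Fire b i p q =
  (b ≤ p i) × (q i + b ≡ p i) × (q (suc i) ≡ suc (p (suc i))) ×
  ((j : ℕ) → j ≢ i → j ≢ suc i → q j ≡ p j)

Succ : ℕ → Partition → Partition → Set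
Succ b p q = Σ ℕ (λ i → Fire b i p q)

data Reach (b n : ℕ) : Partition → Set where
  start : ∀ {p} → (∀ j → p j ≡ single n j) → Reach b n p
  step  : ∀ {p q} → Reach b n p → Succ b p q → Reach b n q

InP : ℕ → ℕ → ℕ → Partition → Set
InP i b n p = Reach b n p × ((j : ℕ) → j < i → p j ≡ b ∸ 1)

inc : ℕ → Partition → Partition
inc i p j = if j <ᵇ i then 0 else (if j ≡ᵇ i then suc (p i) else p j)

-- Below position i both p and inc i p are too small to fire (b − 1 resp. 0 chips), so every
-- firing of either happens at some j ≥ i, where inc i only adds a chip at i and otherwise
-- leaves the partition alone; hence inc i commutes with firing j.  The one firing of
-- inc i p with no counterpart in p is at i when p i = b − 1: the extra chip makes b chips
-- there, and firing them leaves 0 at i and one more chip at i + 1, which is inc (suc i) p.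
-- Since firing is deterministic, these firings exhaust Succ b (inc i p).
module Submission where

open import Defs
open import Data.Nat using (ℕ; suc; _+_; _∸_; _≤_; _<_; _≤?_; _<ᵇ_; _≡ᵇ_; z<s)
open import Data.Nat.Properties
open import Data.Bool using (true; false)
open import Data.Product using (Σ; _×_; _,_)
open import Data.Sum using (_⊎_; inj₁; inj₂)
open import Function using (_∘_)
open import Function.Bundles using (_⇔_; mk⇔)
open import Relation.Binary using (tri<; tri≈; tri>)
open import Relation.Binary.PropositionalEquality
open import Relation.Nullary using (yes; no; contradiction)
open import Relation.Nullary.Reflects using (ofʸ)

private
  variable
    b i j k : ℕ
    p q r : Partition

inc-below : ∀ p → k < i → inc i p k ≡ 0
inc-below {k} {i} _ k<i with k <ᵇ i | <⇒<ᵇ k<i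
... | true | _ = refl

inc-at : ∀ i p → inc i p i ≡ suc (p i)
inc-at i _ with i <ᵇ i | <ᵇ-reflects-< i i
... | true  | ofʸ i<i = contradiction i<i (<-irrefl refl)
... | false | _ with i ≡ᵇ i | ≡⇒≡ᵇ i i refl
...   | true | _ = refl

inc-above : ∀ p → i < k → inc i p k ≡ p k
inc-above {i} {k} _ i<k with k <ᵇ i | <ᵇ-reflects-< k i
... | true  | ofʸ k<i = contradiction k<i (<-asym i<k)
... | false | _ with k ≡ᵇ i | ≡ᵇ⇒≡ k i
...   | true  | k≡i = contradiction (k≡i _) (>⇒≢ i<k)
...   | false | _   = refl

inc-from : i ≤ k → (∀ p → inc i p k ≡ suc (p k)) ⊎ (∀ p → inc i p k ≡ p k)
inc-from i≤k with m≤n⇒m<n∨m≡n i≤k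
... | inj₁ i<k  = inj₂ (λ p → inc-above p i<k)
... | inj₂ refl = inj₁ (inc-at _)

inc-cong-at : ∀ i k → p k ≡ q k → inc i p k ≡ inc i q k
inc-cong-at {p} {q} i k pk≡qk with <-cmp k i
... | tri< k<i _ _ = trans (inc-below p k<i) (sym (inc-below q k<i))
... | tri≈ _ refl _ = trans (inc-at i p) (trans (cong suc pk≡qk) (sym (inc-at i q)))
... | tri> _ _ i<k = trans (inc-above p i<k) (trans pk≡qk (sym (inc-above q i<k)))

≤-inc : i ≤ k → p k ≤ inc i p k
≤-inc {p = p} i≤k with inc-from i≤k
... | inj₁ h = ≤-trans (n≤1+n _) (≤-reflexive (sym (h p)))
... | inj₂ h = ≤-reflexive (sym (h p))

inc-+ : ∀ {m} → i ≤ k → q k + m ≡ p k → inc i q k + m ≡ inc i p k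
inc-+ {q = q} {p = p} i≤k e with inc-from i≤k
... | inj₁ h rewrite h q | h p = cong suc e
... | inj₂ h rewrite h q | h p = e

inc-suc : i ≤ k → q k ≡ suc (p k) → inc i q k ≡ suc (inc i p k)
inc-suc {q = q} {p = p} i≤k e with inc-from i≤k
... | inj₁ h rewrite h q | h p = cong suc e
... | inj₂ h rewrite h q | h p = e

fire : ℕ → ℕ → Partition → Partition
fire b j p k with k ≟ j | k ≟ suc j
... | yes _ | _     = p j ∸ b
... | no _  | yes _ = suc (p k)
... | no _  | no _  = p k

fire-Fire : b ≤ p j → Fire b j p (fire b j p)
fire-Fire {b} {p} {j} b≤pj = b≤pj , fired , carried , unchanged
  where
  fired : fire b j p j + b ≡ p j
  fired with j ≟ j | j ≟ suc j
  ... | yes _  | _ = m∸n+n≡m b≤pj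
  ... | no j≢j | _ = contradiction refl j≢j

  carried : fire b j p (suc j) ≡ suc (p (suc j))
  carried with suc j ≟ j | suc j ≟ suc j
  ... | yes e | _     = contradiction e 1+n≢n
  ... | no _  | yes _ = refl
  ... | no _  | no ne = contradiction refl ne

  unchanged : ∀ k → k ≢ j → k ≢ suc j → fire b j p k ≡ p k
  unchanged k k≢j k≢sj with k ≟ j | k ≟ suc j
  ... | yes e | _     = contradiction e k≢j
  ... | no _  | yes e = contradiction e k≢sj
  ... | no _  | no _  = refl

Fire-functional : Fire b j p q → Fire b j p r → q ≗ r
Fire-functional {b} {j} (_ , qj , qsj , q-else) (_ , rj , rsj , r-else) k with k ≟ j | k ≟ suc j
... | yes refl | _        = +-cancelʳ-≡ b _ _ (trans qj (sym rj))
... | no _     | yes refl = trans qsj (sym rsj)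
... | no k≢j   | no k≢sj  = trans (q-else k k≢j k≢sj) (sym (r-else k k≢j k≢sj))

Fire-respʳ : q ≗ r → Fire b j p r → Fire b j p q
Fire-respʳ {b = b} q≗r (b≤pj , fired , carried , unchanged) =
  b≤pj , trans (cong (_+ b) (q≗r _)) fired , trans (q≗r _) carried ,
  λ k k≢j k≢sj → trans (q≗r k) (unchanged k k≢j k≢sj)

Fire-index-≥ : (∀ k → k < i → p k < b) → Fire b j p q → i ≤ j
Fire-index-≥ {i} {j = j} small (b≤pj , _) with i ≤? j
... | yes i≤j = i≤j
... | no i≰j  = contradiction b≤pj (<⇒≱ (small j (≰⇒> i≰j)))

Fire-inc-index-≥ : 0 < b → Fire b j (inc i p) q → i ≤ j
Fire-inc-index-≥ {b} {i = i} {p} 0<b =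
  Fire-index-≥ (λ k k<i → subst (_< b) (sym (inc-below p k<i)) 0<b)

Fire-prefix-index-≥ : 0 < b → (∀ k → k < i → p k ≡ b ∸ 1) → Fire b j p q → i ≤ j
Fire-prefix-index-≥ {b} 0<b prefix =
  Fire-index-≥ (λ k k<i → subst (_< b) (sym (prefix k k<i)) (≤-reflexive (m+[n∸m]≡n 0<b)))

Fire-inc : i ≤ j → Fire b j p q → Fire b j (inc i p) (inc i q)
Fire-inc {i} {j} {p = p} {q} i≤j (b≤pj , fired , carried , unchanged) =
  ≤-trans b≤pj (≤-inc i≤j) , inc-+ {q = q} {p} i≤j fired ,
  inc-suc {q = q} {p} (m≤n⇒m≤1+n i≤j) carried ,
  λ k k≢j k≢sj → inc-cong-at i k (unchanged k k≢j k≢sj)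

Fire-carry : 0 < b → p i ≡ b ∸ 1 → Fire b i (inc i p) (inc (suc i) p)
Fire-carry {b} {p} {i} 0<b pi≡b-1 =
  ≤-reflexive (sym full) ,
  trans (cong (_+ b) (inc-below p (n<1+n i))) (sym full) ,
  trans (inc-at (suc i) p) (cong suc (sym (inc-above p (n<1+n i)))) ,
  unchanged
  where
  full : inc i p i ≡ b
  full = trans (inc-at i p) (trans (cong suc pi≡b-1) (m+[n∸m]≡n 0<b))

  unchanged : ∀ k → k ≢ i → k ≢ suc i → inc (suc i) p k ≡ inc i p k
  unchanged k k≢i k≢si with <-cmp k i
  ... | tri< k<i _ _ = trans (inc-below p (m<n⇒m<1+n k<i)) (sym (inc-below p k<i))
  ... | tri≈ _ k≡i _ = contradiction k≡i k≢i
  ... | tri> _ _ i<k =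
    trans (inc-above p (≤∧≢⇒< i<k (k≢si ∘ sym))) (sym (inc-above p i<k))

legal-or-carry : i ≤ j → b ≤ inc i p j → b ≤ p j ⊎ (j ≡ i × p i ≡ b ∸ 1)
legal-or-carry {i} {j} {b} {p} i≤j b≤incj with m≤n⇒m<n∨m≡n i≤j
... | inj₁ i<j  = inj₁ (subst (b ≤_) (inc-above p i<j) b≤incj)
... | inj₂ refl with m≤n⇒m<n∨m≡n (subst (b ≤_) (inc-at i p) b≤incj)
...   | inj₁ b<suc = inj₁ (≤-pred b<suc)
...   | inj₂ b≡suc = inj₂ (refl , sym (cong (_∸ 1) b≡suc))

LiftedSucc : ℕ → ℕ → Partition → Partition → Set
LiftedSucc b i p q = Σ Partition (λ q′ → Succ b p q′ × q ≗ inc i q′)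

Succ-inc-cases : 0 < b → Succ b (inc i p) q →
                 LiftedSucc b i p q ⊎ (p i ≡ b ∸ 1 × q ≗ inc (suc i) p)
Succ-inc-cases {b} {i} {p} 0<b (j , firing@(b≤incj , _))
  with i≤j ← Fire-inc-index-≥ {i = i} 0<b firing | legal-or-carry i≤j b≤incj
... | inj₁ b≤pj =
  inj₁ (fire b j p , (j , fire-Fire b≤pj) ,
        Fire-functional firing (Fire-inc i≤j (fire-Fire b≤pj)))
... | inj₂ (refl , pi≡b-1) = inj₂ (pi≡b-1 , Fire-functional firing (Fire-carry 0<b pi≡b-1))

LiftedSucc⇒Succ-inc : 0 < b → (∀ k → k < i → p k ≡ b ∸ 1) →
                      LiftedSucc b i p q → Succ b (inc i p) q
LiftedSucc⇒Succ-inc 0<b prefix (q′ , (j , firing) , q≗incq′) =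
  j , Fire-respʳ q≗incq′ (Fire-inc (Fire-prefix-index-≥ 0<b prefix firing) firing)

lemma2 : (b n i : ℕ) → 2 ≤ b → (p : Partition) → InP i b n p →
    (p i ≢ b ∸ 1 →
      (q : Partition) →
        Succ b (inc i p) q ⇔
          Σ Partition (λ q′ → Succ b p q′ × ((j : ℕ) → q j ≡ inc i q′ j)))
    ×
    (p i ≡ b ∸ 1 →
      (q : Partition) →
        Succ b (inc i p) q ⇔
          (Σ Partition (λ q′ → Succ b p q′ × ((j : ℕ) → q j ≡ inc i q′ j))
            ⊎ ((j : ℕ) → q j ≡ inc (suc i) p j)))
lemma2 b n i 2≤b p (_ , prefix) = no-carry , carry
  where
  0<b : 0 < b
  0<b = <-trans z<s 2≤b

  from-lift : ∀ {q} → LiftedSucc b i p q → Succ b (inc i p) q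
  from-lift = LiftedSucc⇒Succ-inc 0<b prefix

  no-carry : p i ≢ b ∸ 1 → ∀ q → Succ b (inc i p) q ⇔ LiftedSucc b i p q
  no-carry pi≢b-1 q = mk⇔ to from-lift
    where
    to : Succ b (inc i p) q → LiftedSucc b i p q
    to s with Succ-inc-cases 0<b s
    ... | inj₁ lifted       = lifted
    ... | inj₂ (pi≡b-1 , _) = contradiction pi≡b-1 pi≢b-1

  carry : p i ≡ b ∸ 1 → ∀ q → Succ b (inc i p) q ⇔ (LiftedSucc b i p q ⊎ q ≗ inc (suc i) p)
  carry pi≡b-1 q = mk⇔ to from
    where
    to : Succ b (inc i p) q → LiftedSucc b i p q ⊎ q ≗ inc (suc i) p
    to s with Succ-inc-cases 0<b s
    ... | inj₁ lifted        = inj₁ lifted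
    ... | inj₂ (_ , q≗carry) = inj₂ q≗carry

    from : LiftedSucc b i p q ⊎ q ≗ inc (suc i) p → Succ b (inc i p) q
    from (inj₁ lifted)  = from-lift lifted
    from (inj₂ q≗carry) = i , Fire-respʳ q≗carry (Fire-carry 0<b pi≡b-1)
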